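{- Let $n=p_1p_2p_3$ ($p_i$ distinct primes), $\gcd(n,6)=1$, $n>1000$, $G$ cyclic of order $n$, $\mathrm{ord}(g)=n$. Let $a,b,c$ be integers with $1+c=a+b$ and $1<c<\frac n2<n-b\le n-a<n-1$, such that $S=(g)\cdot(cg)\cdot((n-b)g)\cdot((n-a)g)$ is a reduced minimal zero-sum sequence and one of (A2), (A3), (A4) below holds. Let $s=\lfloor b/a\rfloor$ and assume $s\le9$ and condition (B). Suppose $\lceil\frac nc\rceil<\lceil\frac nb\rceil$ and the interval $[\frac nc,\frac nb]$ contains exactly one integer $m_1$. If $m_1\ne5$ and $m_1\ne7$, then $\mathrm{ind}(S)=1$.
   Context: Minimal zero-sum sequence: a finite unordered sequence of elements of $G$ whose terms sum to $0$ and no proper nonempty subsequence of which sums to $0$. $S$ is reduced if for every prime $p\mid n$ the sequence $(pg)\cdot(pcg)\cdot(p(n-b)g)\cdot(p(n-a)g)$ is not minimal zero-sum. For a generator $h$ of $G$, write $S=(m_1'h)\cdots(m_4'h)$ with $m_j'\in[1,n]$, $\|S\|_h=(m_1'+\cdots+m_4')/n$, $\mathrm{ind}(S)=\min\{\|S\|_h:\langle h\rangle=G\}$. Conditions (for a suitable labeling of the primes): (A2) $\{\gcd(c,n),\gcd(b,n),\gcd(a,n)\}=\{p_1,p_2,p_1p_2\}$; (A3) $\gcd(c+1,n)=p_1p_2$, $\gcd(b-1,n)=p_1p_3$, $\gcd(a-1,n)=p_2p_3$; (A4) $\gcd(c,n)=p_1p_2$, $\gcd(b,n)=p_1p_3$,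 $\gcd(a,n)=p_2p_3$. Condition (B): for every integer $t$ with $0\le t\le\lfloor s/2\rfloor-1$, the interval $[\frac{(2s-2t-1)n}{2b},\frac{(s-t)n}{b}]$ contains no integer coprime to $n$. -}

module Defs where

open import Data.Nat using (ℕ; zero; suc; _+_; _*_; _∸_; _≤_; _<_; NonZero)
open import Data.Nat.DivMod using (_/_; _%_)
open import Data.Nat.GCD using (gcd)
open import Data.List using (List; []; _∷_; length)
open import Data.Nat.ListAction using (sum)
open import Data.List.Membership.Propositional using (_∈_)
open import Data.List.Relation.Binary.Sublist.Propositional using (_⊆_)
open import Data.Product using (_×_; Σ; ∃; ∃-syntax)
open import Relation.Binary.PropositionalEquality using (_≡_; _≢_)
open import Relation.Nullary using (¬_)
import Data.Nat.Base
import Data.Nat.Primality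
import Data.Nat.Divisibility
import Data.Nat.Coprimality

-- The cyclic group G of order n is modelled as ℤ/nℤ: an element is
-- represented by a natural number, two naturals denote the same element
-- iff they agree mod n.

module _ (n : ℕ) .{{_ : NonZero n}} where

  _≈G_ : ℕ → ℕ → Set
  x ≈G y = x % n ≡ y % n

  HasOrder : ℕ → ℕ → Set
  HasOrder g k = (0 < k) × ((k * g) ≈G 0) × (∀ j → 0 < j → (j * g) ≈G 0 → k ≤ j)

  Generates : ℕ → Set
  Generates h = ∀ x → ∃[ k ] ((k * h) ≈G x)

  ZeroSum : List ℕ → Set
  ZeroSum T = sum T ≈G 0

  -- minimal zero-sum sequence: nonempty, zero-sum, and no proper nonempty
  -- subsequence (sub-multiset, represented by a sublist) is zero-sum
  MinimalZeroSum : List ℕ → Set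
  MinimalZeroSum S = (0 < length S) × ZeroSum S ×
    (∀ T → T ⊆ S → 0 < length T → length T < length S → ¬ ZeroSum T)

  seqS : ℕ → ℕ → ℕ → ℕ → ℕ → List ℕ
  seqS x g c b a = (x * g) ∷ (x * (c * g)) ∷ (x * ((n ∸ b) * g)) ∷ (x * ((n ∸ a) * g)) ∷ []

  Reduced : ℕ → ℕ → ℕ → ℕ → Set
  Reduced g c b a = ∀ p → Data.Nat.Primality.Prime p → Data.Nat.Divisibility._∣_ p n →
    ¬ MinimalZeroSum (seqS p g c b a)

  Rep : ℕ → ℕ → ℕ → Set
  Rep h x m = (1 ≤ m) × (m ≤ n) × ((m * h) ≈G x)

  -- SumRep h S M : M = m_1' + ... + m_k' where S = (m_1' h)...(m_k' h),
  -- so that ‖S‖_h = M / n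
  data SumRep (h : ℕ) : List ℕ → ℕ → Set where
    []  : SumRep h [] 0
    _∷_ : ∀ {x xs m M} → Rep h x m → SumRep h xs M → SumRep h (x ∷ xs) (m + M)

  -- ind(S) = 1, i.e. min { ‖S‖_h : ⟨h⟩ = G } = 1, with ‖S‖_h = M/n:
  -- the value 1 is attained and is a lower bound.
  IndexOne : List ℕ → Set
  IndexOne S = (∃[ h ] (Generates h × SumRep h S n)) ×
               (∀ h M → Generates h → SumRep h S M → n ≤ M)

ceilDiv : ℕ → (c : ℕ) → .{{_ : NonZero c}} → ℕ
ceilDiv n c = (n + (c ∸ 1)) / c

CondA2 : (n a b c p₁ p₂ p₃ : ℕ) → Set
CondA2 n a b c p₁ p₂ p₃ =
  (∀ x → x ∈ L → x ∈ R) × (∀ x → x ∈ R → x ∈ L)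
  where
  L = gcd c n ∷ gcd b n ∷ gcd a n ∷ []
  R = p₁ ∷ p₂ ∷ (p₁ * p₂) ∷ []

CondA3 : (n a b c p₁ p₂ p₃ : ℕ) → Set
CondA3 n a b c p₁ p₂ p₃ =
  (gcd (c + 1) n ≡ p₁ * p₂) × (gcd (b ∸ 1) n ≡ p₁ * p₃) × (gcd (a ∸ 1) n ≡ p₂ * p₃)

CondA4 : (n a b c p₁ p₂ p₃ : ℕ) → Set
CondA4 n a b c p₁ p₂ p₃ =
  (gcd c n ≡ p₁ * p₂) × (gcd b n ≡ p₁ * p₃) × (gcd a n ≡ p₂ * p₃)

-- Condition (B): for every integer t with 0 ≤ t ≤ ⌊s/2⌋ - 1 (i.e. t+1 ≤ ⌊s/2⌋),
-- no integer k with (2s-2t-1)n/(2b) ≤ k ≤ (s-t)n/b is coprime to n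
-- (denominators cleared; such k are necessarily positive).
CondB : (n b s : ℕ) → Set
CondB n b s = ∀ t k → t + 1 ≤ Data.Nat.Base.⌊ s /2⌋ →
  ((2 * s ∸ 2 * t ∸ 1) * n ≤ 2 * b * k) → (b * k ≤ (s ∸ t) * n) →
  ¬ Data.Nat.Coprimality.Coprime k n

module Submission where

open import Defs
open import Data.Nat using (ℕ; _+_; _*_; _∸_; _≤_; _<_; NonZero)
open import Data.Nat.DivMod using (_/_)
open import Data.Nat.GCD using (gcd)
open import Data.Nat.Primality using (Prime)
open import Data.Sum using (_⊎_)
open import Relation.Binary.PropositionalEquality using (_≡_; _≢_)

open import Data.Nat.Base using (zero; suc; z≤n; s≤s; s≤s⁻¹; _^_; >-nonZero; >-nonZero⁻¹; ≢-nonZero⁻¹; nonTrivial⇒≢1)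
open import Data.Nat.Properties
open import Data.Nat.DivMod
  using (_%_; %-distribˡ-+; %-distribˡ-*; [m+kn]%n≡m%n; m*n%n≡0; m%n<n; m≡m%n+[m/n]*n;
         m/n≡0⇒m<n; m*n/n≡m; /-monoˡ-≤)
open import Data.Nat.Divisibility
  using (_∣_; _∣?_; divides; ∣-refl; ∣-trans; ∣1⇒≡1; ∣⇒≤; m%n≡0⇒n∣m; ∣m+n∣m⇒∣n; m∣m*n; n∣m*n)
open import Data.Nat.Coprimality using (Coprime; coprime-Bézout; coprime-divisor; gcd≡1⇒coprime)
open import Data.Nat.GCD using (module Bézout)
open import Data.Nat.Primality using (prime⇒irreducible; prime⇒nonTrivial)
open import Data.Nat.Tactic.RingSolver using (solve-∀)
open import Data.Nat.ListAction using (sum)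
open import Data.Fin.Base using (Fin; toℕ; zero; suc)
open import Data.Fin.Properties using (pigeonhole; toℕ<n; any?)
open import Data.List.Base using ([]; _∷_)
open import Data.Product using (_,_; _×_; proj₁; proj₂; ∃-syntax; ∃₂)
open import Data.Sum using (inj₁; inj₂)
open import Data.Empty using (⊥; ⊥-elim)
open import Relation.Nullary using (¬_; yes; no)
open import Relation.Binary.PropositionalEquality
  using (refl; sym; trans; cong; cong₂; subst; subst₂; module ≡-Reasoning)

-- Lemma 4.4: writing m for the unique integer m₁ ∈ [n/c, n/b], we show
-- ind(S) = 1 by exhibiting the generator h = m⁻¹·g.  With respect to h
-- the terms g, cg, (n−b)g, (n−a)g of S have the representatives
--   m,  cm − n,  n − bm,  n − am,
-- whose total is (1 + c − a − b)m + n = n, while no generator can give a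
-- smaller total: the total of any representation of a nonempty zero-sum
-- sequence is a positive multiple of n.  The only real input is that m is
-- a unit modulo n, which follows from m ≤ 8, m ∉ {5, 7} and gcd(n,6) = 1:
--   * if s = ⌊b/a⌋ = 1, i.e. b < 2a, the window c(m−1) < n < b(m+1) forces m ≤ 8;
--   * if s ≥ 2, condition (B) with t = 0 forces n < 8b, hence m < 8 since
--     bm ≤ n: otherwise its interval would contain four consecutive integers
--     none of them coprime to n, impossible for n = p₁p₂p₃ coprime to 6.
-- The file develops arithmetic modulo n and the two halves of ind(S) = 1,
-- then runs of non-units, then the bound on m, and finally the theorem.

module Modular (n : ℕ) .{{_ : NonZero n}} where

  open ≡-Reasoning

  infix 4 _≈_
  _≈_ : ℕ → ℕ → Set
  _≈_ = _≈G_ n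

  ≡⇒≈ : ∀ {x y} → x ≡ y → x ≈ y
  ≡⇒≈ = cong (_% n)

  +-cong : ∀ {x x′ y y′} → x ≈ x′ → y ≈ y′ → x + y ≈ x′ + y′
  +-cong {x} {x′} {y} {y′} x≈x′ y≈y′ = begin
    (x + y) % n            ≡⟨ %-distribˡ-+ x y n ⟩
    (x % n + y % n) % n    ≡⟨ cong₂ (λ u v → (u + v) % n) x≈x′ y≈y′ ⟩
    (x′ % n + y′ % n) % n  ≡⟨ %-distribˡ-+ x′ y′ n ⟨
    (x′ + y′) % n          ∎

  *-cong : ∀ {x x′ y y′} → x ≈ x′ → y ≈ y′ → x * y ≈ x′ * y′
  *-cong {x} {x′} {y} {y′} x≈x′ y≈y′ = begin
    (x * y) % n              ≡⟨ %-distribˡ-* x y n ⟩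
    (x % n * (y % n)) % n    ≡⟨ cong₂ (λ u v → (u * v) % n) x≈x′ y≈y′ ⟩
    (x′ % n * (y′ % n)) % n  ≡⟨ %-distribˡ-* x′ y′ n ⟨
    (x′ * y′) % n            ∎

  +-multiple : ∀ x k → x + k * n ≈ x
  +-multiple x k = [m+kn]%n≡m%n x k n

  ∸n≈ : ∀ {x} → n ≤ x → x ∸ n ≈ x
  ∸n≈ {x} n≤x = trans (sym (+-multiple (x ∸ n) 1))
                      (≡⇒≈ (trans (cong (x ∸ n +_) (*-identityˡ n)) (m∸n+n≡m n≤x)))

  n∸≈ : ∀ b m → b * m ≤ n → n ∸ b * m ≈ (n ∸ b) * m
  n∸≈ b zero _ = trans (≡⇒≈ (trans (cong (n ∸_) (*-zeroʳ b)) (sym (*-identityˡ n))))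
                       (trans (+-multiple 0 1) (≡⇒≈ (sym (*-zeroʳ (n ∸ b)))))
  n∸≈ b (suc k) bm≤n = sym (trans (≡⇒≈ expand) (+-multiple (n ∸ b * suc k) k))
    where
    expand : (n ∸ b) * suc k ≡ n ∸ b * suc k + k * n
    expand = begin
      (n ∸ b) * suc k            ≡⟨ *-distribʳ-∸ (suc k) n b ⟩
      n * suc k ∸ b * suc k      ≡⟨ cong (_∸ b * suc k) (*-suc n k) ⟩
      (n + n * k) ∸ b * suc k    ≡⟨ +-∸-comm (n * k) bm≤n ⟩
      n ∸ b * suc k + n * k      ≡⟨ cong (n ∸ b * suc k +_) (*-comm n k) ⟩
      n ∸ b * suc k + k * n      ∎

  -- An element of order n is a unit: a common factor d of g and n would
  -- give (n/d)·g ≡ 0 with 0 < n/d, so n ≤ n/d and d = 1.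
  order-n⇒coprime : ∀ {g} → HasOrder n g n → Coprime g n
  order-n⇒coprime {g} (_ , _ , minimal) {d} (divides g′ g≡g′d , divides n′ n≡n′d) =
    *-cancelˡ-≡ d 1 n (trans (cong (_* d) (sym n′≡n)) (trans (sym n≡n′d) (sym (*-identityʳ n))))
    where
    0<n′ : 0 < n′
    0<n′ = n≢0⇒n>0 (λ n′≡0 → ≢-nonZero⁻¹ n (trans n≡n′d (cong (_* d) n′≡0)))
    n′g≈0 : n′ * g ≈ 0
    n′g≈0 = trans (≡⇒≈ (begin
      n′ * g          ≡⟨ cong (n′ *_) g≡g′d ⟩
      n′ * (g′ * d)   ≡⟨ reorder n′ g′ d ⟩
      g′ * (n′ * d)   ≡⟨ cong (g′ *_) n≡n′d ⟨
      g′ * n          ∎)) (+-multiple 0 g′)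
      where
      reorder : ∀ x y z → x * (y * z) ≡ y * (x * z)
      reorder = solve-∀
    n′≡n : n′ ≡ n
    n′≡n = ≤-antisym (∣⇒≤ (divides d (trans n≡n′d (*-comm n′ d)))) (minimal n′ 0<n′ n′g≈0)

  coprime⇒invertible : ∀ {m} → Coprime m n → ∃[ w ] (w * m ≈ 1)
  coprime⇒invertible {m} cop with coprime-Bézout cop
  ... | Bézout.+- x y 1+yn≡xm = x , trans (≡⇒≈ (sym 1+yn≡xm)) (+-multiple 1 y)
  ... | Bézout.-+ x y 1+xm≡yn =
    (n ∸ 1) * x , trans (sym (+-multiple _ 1)) (trans (≡⇒≈ identity) (+-multiple 1 ((n ∸ 1) * y)))
    where
    t : ℕ
    t = n ∸ 1
    identity : t * x * m + 1 * n ≡ 1 + t * y * n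
    identity = begin
      t * x * m + 1 * n        ≡⟨ cong (λ k → t * x * m + 1 * k) (sym (m∸n+n≡m (>-nonZero⁻¹ n))) ⟩
      t * x * m + 1 * (t + 1)  ≡⟨ spread t x m ⟩
      1 + t * (1 + x * m)      ≡⟨ cong (λ k → 1 + t * k) 1+xm≡yn ⟩
      1 + t * (y * n)          ≡⟨ cong (1 +_) (*-assoc t y n) ⟨
      1 + t * y * n            ∎
      where
      spread : ∀ t x m → t * x * m + 1 * (t + 1) ≡ 1 + t * (1 + x * m)
      spread = solve-∀

  unit⇒generates : ∀ {k h} → k * h ≈ 1 → Generates n h
  unit⇒generates {k} {h} kh≈1 x = x * k , (begin
    (x * k * h) % n    ≡⟨ cong (_% n) (*-assoc x k h) ⟩
    (x * (k * h)) % n  ≡⟨ *-cong {x} refl kh≈1 ⟩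
    (x * 1) % n        ≡⟨ cong (_% n) (*-identityʳ x) ⟩
    x % n              ∎)

  sumRep-sum : ∀ {h S M} → SumRep n h S M → M * h ≈ sum S
  sumRep-sum [] = refl
  sumRep-sum {h} (_∷_ {m = m} {M = M} (_ , _ , mh≈x) rest) =
    trans (≡⇒≈ (*-distribʳ-+ h m M)) (+-cong mh≈x (sumRep-sum rest))

  generator-annihilates : ∀ {h M} → Generates n h → M * h ≈ 0 → M ≈ 0
  generator-annihilates {h} {M} gen Mh≈0 with gen 1
  ... | k , kh≈1 = begin
    M % n              ≡⟨ cong (_% n) (*-identityʳ M) ⟨
    (M * 1) % n        ≡⟨ *-cong {M} refl kh≈1 ⟨
    (M * (k * h)) % n  ≡⟨ cong (_% n) (reorder M k h) ⟩
    (k * (M * h)) % n  ≡⟨ *-cong {k} refl Mh≈0 ⟩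
    (k * 0) % n        ≡⟨ cong (_% n) (*-zeroʳ k) ⟩
    0 % n              ∎
    where
    reorder : ∀ x y z → x * (y * z) ≡ y * (x * z)
    reorder = solve-∀

  -- Lower bound ind(S) ≥ 1: for a nonempty zero-sum sequence every
  -- representation total is a positive multiple of n.
  index-lower-bound : ∀ {h x xs M} → ZeroSum n (x ∷ xs) → Generates n h →
                      SumRep n h (x ∷ xs) M → n ≤ M
  index-lower-bound {M = M} zero-sum gen rep@(_∷_ {m = m} (1≤m , _) _) =
    ∣⇒≤ {{>-nonZero (≤-trans 1≤m (m≤m+n m _))}} (m%n≡0⇒n∣m M n M%n≡0)
    where
    M%n≡0 : M % n ≡ 0
    M%n≡0 = trans (generator-annihilates gen (trans (sumRep-sum rep) zero-sum)) (m*n%n≡0 0 n)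

  indexOne-of-witness : ∀ {x xs} → ZeroSum n (x ∷ xs) →
                        ∃[ h ] (Generates n h × SumRep n h (x ∷ xs) n) → IndexOne n (x ∷ xs)
  indexOne-of-witness zero-sum witness =
    witness , λ _ _ gen rep → index-lower-bound zero-sum gen rep

  rep-of-multiple : ∀ {g h m t r} → m * h ≈ g → 1 ≤ r → r ≤ n → r ≈ t * m → Rep n h (t * g) r
  rep-of-multiple {g} {h} {m} {t} {r} mh≈g 1≤r r≤n r≈tm = 1≤r , r≤n , (begin
    (r * h) % n        ≡⟨ *-cong r≈tm refl ⟩
    (t * m * h) % n    ≡⟨ cong (_% n) (*-assoc t m h) ⟩
    (t * (m * h)) % n  ≡⟨ *-cong {t} refl mh≈g ⟩
    (t * g) % n        ∎)

  representative-total : ∀ {a b c m} → 1 + c ≡ a + b → n ≤ c * m → b * m ≤ n → a * m ≤ n →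
                         m + ((c * m ∸ n) + ((n ∸ b * m) + ((n ∸ a * m) + 0))) ≡ n
  representative-total {a} {b} {c} {m} 1+c≡a+b n≤cm bm≤n am≤n =
    +-cancelʳ-≡ (n + (b * m + a * m)) _ _ (begin
      m + (P + (Q + (R + 0))) + (n + (b * m + a * m))  ≡⟨ regroup m P Q R n (b * m) (a * m) ⟩
      m + (P + n) + (Q + b * m) + (R + a * m)          ≡⟨ cong₂ (λ x y → m + x + y + (R + a * m))
                                                             (m∸n+n≡m n≤cm) (m∸n+n≡m bm≤n) ⟩
      m + c * m + n + (R + a * m)                       ≡⟨ cong (m + c * m + n +_) (m∸n+n≡m am≤n) ⟩
      m + c * m + n + n                                 ≡⟨ collect m c n ⟩
      (1 + c) * m + (n + n)                             ≡⟨ cong (λ x → x * m + (n + n)) 1+c≡a+b ⟩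
      (a + b) * m + (n + n)                             ≡⟨ expand a b m n ⟩
      n + (n + (b * m + a * m))                         ∎)
    where
    P Q R : ℕ
    P = c * m ∸ n
    Q = n ∸ b * m
    R = n ∸ a * m
    regroup : ∀ m P Q R n B A →
              m + (P + (Q + (R + 0))) + (n + (B + A)) ≡ m + (P + n) + (Q + B) + (R + A)
    regroup = solve-∀
    collect : ∀ m c n → m + c * m + n + n ≡ (1 + c) * m + (n + n)
    collect = solve-∀
    expand : ∀ a b m n → (a + b) * m + (n + n) ≡ n + (n + (b * m + a * m))
    expand = solve-∀

  -- The upper bound: if m is a unit with bm < n < cm ≤ 2n, a ≤ b and
  -- 1 + c = a + b, then h = m⁻¹·g is a generator representing S with total n.
  multiplier-representation :
    ∀ {g a b c m} .{{_ : NonZero b}} → HasOrder n g n → Coprime m n → 1 ≤ m →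
    1 + c ≡ a + b → a ≤ b → b * m < n → n < c * m → c * m ≤ n + n →
    ∃[ h ] (Generates n h × SumRep n h (seqS n 1 g c b a) n)
  multiplier-representation {g} {a} {b} {c} {m} order unit 1≤m 1+c≡a+b a≤b bm<n n<cm cm≤2n =
    u * g , unit⇒generates {m * w} generator ,
    subst (SumRep n (u * g) (seqS n 1 g c b a))
          (representative-total {a} {b} {c} {m} 1+c≡a+b (<⇒≤ n<cm) (<⇒≤ bm<n) (<⇒≤ am<n))
          (rep₁ ∷ scale₁ rep-c ∷ scale₁ (rep-neg b bm<n) ∷ scale₁ (rep-neg a am<n) ∷ [])
    where
    u w : ℕ
    u = proj₁ (coprime⇒invertible unit)
    w = proj₁ (coprime⇒invertible (order-n⇒coprime order))
    um≈1 : u * m ≈ 1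
    um≈1 = proj₂ (coprime⇒invertible unit)
    wg≈1 : w * g ≈ 1
    wg≈1 = proj₂ (coprime⇒invertible (order-n⇒coprime order))
    swap : ∀ x y z v → x * y * (z * v) ≡ z * x * (y * v)
    swap = solve-∀
    m·h≈g : m * (u * g) ≈ g
    m·h≈g = trans (≡⇒≈ (reorder m u g)) (trans (*-cong um≈1 refl) (≡⇒≈ (*-identityˡ g)))
      where
      reorder : ∀ x y z → x * (y * z) ≡ y * x * z
      reorder = solve-∀
    generator : m * w * (u * g) ≈ 1
    generator = trans (≡⇒≈ (swap m w u g)) (*-cong um≈1 wg≈1)
    am<n : a * m < n
    am<n = ≤-<-trans (*-monoˡ-≤ m a≤b) bm<n
    m≤n : m ≤ n
    m≤n = ≤-trans (m≤n*m m b) (<⇒≤ bm<n)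
    scale₁ : ∀ {x r} → Rep n (u * g) x r → Rep n (u * g) (1 * x) r
    scale₁ {x} = subst (λ y → Rep n (u * g) y _) (sym (*-identityˡ x))
    rep₁ : Rep n (u * g) (1 * g) m
    rep₁ = rep-of-multiple {t = 1} m·h≈g 1≤m m≤n (≡⇒≈ (sym (*-identityˡ m)))
    rep-c : Rep n (u * g) (c * g) (c * m ∸ n)
    rep-c = rep-of-multiple {t = c} m·h≈g (m<n⇒0<n∸m n<cm) (m≤n+o⇒m∸n≤o (c * m) n cm≤2n) (∸n≈ (<⇒≤ n<cm))
    rep-neg : ∀ t → t * m < n → Rep n (u * g) ((n ∸ t) * g) (n ∸ t * m)
    rep-neg t tm<n = rep-of-multiple {t = n ∸ t} m·h≈g (m<n⇒0<n∸m tm<n) (m∸n≤m n (t * m)) (n∸≈ t m (<⇒≤ tm<n))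

open Modular using (order-n⇒coprime; indexOne-of-witness; multiplier-representation)

NoRunOfFour : ℕ → Set
NoRunOfFour n = ∀ q → ¬ (∀ (i : Fin 4) → ¬ Coprime (q + toℕ i) n)

coprime-* : ∀ {k x y} → Coprime k x → Coprime k y → Coprime k (x * y)
coprime-* {k} {x} cx cy {d} (d∣k , d∣xy) = cy (d∣k , coprime-divisor d-coprime-x d∣xy)
  where
  d-coprime-x : Coprime d x
  d-coprime-x (e∣d , e∣x) = cx (∣-trans e∣d d∣k , e∣x)

coprime-to-prime : ∀ {k p} → Prime p → ¬ p ∣ k → Coprime k p
coprime-to-prime pr p∤k (d∣k , d∣p) with prime⇒irreducible pr d∣p
... | inj₁ d≡1 = d≡1
... | inj₂ refl = ⊥-elim (p∤k d∣k)

coprime-divisorˡ : ∀ {d n k} → d ∣ n → Coprime n k → Coprime d k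
coprime-divisorˡ d∣n cop (e∣d , e∣k) = cop (∣-trans e∣d d∣n , e∣k)

coprime∧∣power⇒≡1 : ∀ {d k} e → Coprime d k → d ∣ k ^ e → d ≡ 1
coprime∧∣power⇒≡1 zero _ d∣1 = ∣1⇒≡1 d∣1
coprime∧∣power⇒≡1 (suc e) cop d∣kᵉ⁺¹ = coprime∧∣power⇒≡1 e cop (coprime-divisor cop d∣kᵉ⁺¹)

∣power⇒coprime : ∀ {m n k} e → Coprime n k → m ∣ k ^ e → Coprime m n
∣power⇒coprime e cop m∣kᵉ (d∣m , d∣n) =
  coprime∧∣power⇒≡1 e (coprime-divisorˡ d∣n cop) (∣-trans d∣m m∣kᵉ)

gap∣6 : ∀ {d} → 0 < d → d ≤ 3 → d ∣ 6
gap∣6 {1} _ _ = divides 6 refl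
gap∣6 {2} _ _ = divides 3 refl
gap∣6 {3} _ _ = divides 2 refl
gap∣6 {suc (suc (suc (suc _)))} _ (s≤s (s≤s (s≤s ())))

divides-two-of-four⇒∣6 : ∀ {r q} (i j : Fin 4) → toℕ i < toℕ j →
                         r ∣ q + toℕ i → r ∣ q + toℕ j → r ∣ 6
divides-two-of-four⇒∣6 {r} {q} i j i<j r∣qi r∣qj =
  ∣-trans (∣m+n∣m⇒∣n (subst (r ∣_) split r∣qj) r∣qi)
          (gap∣6 (m<n⇒0<n∸m i<j) (≤-trans (m∸n≤m (toℕ j) (toℕ i)) (s≤s⁻¹ (toℕ<n j))))
  where
  split : q + toℕ j ≡ (q + toℕ i) + (toℕ j ∸ toℕ i)
  split = trans (cong (q +_) (sym (m+[n∸m]≡n (<⇒≤ i<j)))) (sym (+-assoc q (toℕ i) _))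

-- If n = p₁p₂p₃ is coprime to 6, it has no run of four: each of four
-- non-units is divisible by some pᵢ, so by pigeonhole two of them are
-- divisible by the same pᵢ, which then divides 6.
no-run-of-four : ∀ {n p₁ p₂ p₃} → Prime p₁ → Prime p₂ → Prime p₃ →
                 n ≡ p₁ * p₂ * p₃ → Coprime n 6 → NoRunOfFour n
no-run-of-four {n} {p₁} {p₂} {p₃} pr₁ pr₂ pr₃ n≡p₁p₂p₃ cop6 q non-units =
  collision-impossible (pigeonhole (s≤s (s≤s (s≤s (s≤s z≤n)))) tag)
  where
  p : Fin 3 → ℕ
  p zero = p₁
  p (suc zero) = p₂
  p (suc (suc zero)) = p₃
  prime-at : ∀ i → Prime (p i)
  prime-at zero = pr₁
  prime-at (suc zero) = pr₂
  prime-at (suc (suc zero)) = pr₃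
  p∣n : ∀ i → p i ∣ n
  p∣n i = subst (p i ∣_) (sym n≡p₁p₂p₃) (factor i)
    where
    factor : ∀ i → p i ∣ p₁ * p₂ * p₃
    factor zero = ∣-trans (m∣m*n p₂) (m∣m*n p₃)
    factor (suc zero) = ∣-trans (n∣m*n p₁) (m∣m*n p₃)
    factor (suc (suc zero)) = n∣m*n (p₁ * p₂)
  shared-prime : ∀ {k} → ¬ Coprime k n → ∃[ i ] (p i ∣ k)
  shared-prime {k} non-unit with any? (λ i → p i ∣? k)
  ... | yes found = found
  ... | no none = ⊥-elim (non-unit (subst (Coprime k) (sym n≡p₁p₂p₃)
          (coprime-* (coprime-* (unit zero) (unit (suc zero))) (unit (suc (suc zero))))))
    where
    unit : ∀ i → Coprime k (p i)
    unit i = coprime-to-prime (prime-at i) (λ p∣k → none (i , p∣k))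
  tag : Fin 4 → Fin 3
  tag i = proj₁ (shared-prime (non-units i))
  divisor : ∀ i → p (tag i) ∣ q + toℕ i
  divisor i = proj₂ (shared-prime (non-units i))
  collision-impossible : ∃₂ (λ i j → toℕ i < toℕ j × tag i ≡ tag j) → ⊥
  collision-impossible (i , j , i<j , tagᵢ≡tagⱼ) =
    nonTrivial⇒≢1 {{prime⇒nonTrivial (prime-at (tag j))}}
      (cop6 (p∣n (tag j) , divides-two-of-four⇒∣6 i j i<j
                             (subst (λ t → p t ∣ q + toℕ i) tagᵢ≡tagⱼ (divisor i)) (divisor j)))

-- Condition (B) with t = 0: no integer in [(2s−1)n/(2b), sn/b] is a unit.
-- If s ≥ 2 and 8b ≤ n, this interval of length n/(2b) ≥ 4 contains the four
-- consecutive integers q₀ + i (i < 4), q₀ = ⌊(2s−1)n/(2b)⌋ + 1, so n < 8b.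
condB⇒n<8b : ∀ {n b s} .{{_ : NonZero b}} → 2 ≤ s → CondB n b s → NoRunOfFour n → n < 8 * b
condB⇒n<8b {s = zero} () _ _
condB⇒n<8b {s = suc zero} (s≤s ()) _ _
condB⇒n<8b {n} {b} {s@(suc (suc _))} _ condB no-run with n <? 8 * b
... | yes n<8b = n<8b
... | no n≮8b = ⊥-elim (no-run (1 + q) λ i → condB 0 (1 + q + toℕ i) (s≤s z≤n) (lower i) (upper i))
  where
  instance
    2b≢0 : NonZero (2 * b)
    2b≢0 = >-nonZero (*-monoʳ-< 2 (>-nonZero⁻¹ b))
  K q : ℕ
  K = 2 * s ∸ 1
  q = K * n / (2 * b)
  division : K * n ≡ K * n % (2 * b) + q * (2 * b)
  division = m≡m%n+[m/n]*n (K * n) (2 * b)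
  open ≤-Reasoning
  lower : ∀ i → K * n ≤ 2 * b * (1 + q + toℕ i)
  lower i = begin
    K * n                           ≡⟨ division ⟩
    K * n % (2 * b) + q * (2 * b)   ≤⟨ +-monoˡ-≤ (q * (2 * b)) (<⇒≤ (m%n<n (K * n) (2 * b))) ⟩
    2 * b + q * (2 * b)             ≡⟨ factor (2 * b) q ⟩
    2 * b * (1 + q)                 ≤⟨ *-monoʳ-≤ (2 * b) (m≤m+n (1 + q) (toℕ i)) ⟩
    2 * b * (1 + q + toℕ i)         ∎
    where
    factor : ∀ x q → x + q * x ≡ x * (1 + q)
    factor = solve-∀
  upper : ∀ i → b * (1 + q + toℕ i) ≤ s * n
  upper i = *-cancelˡ-≤ 2 (begin
    2 * (b * (1 + q + toℕ i))              ≤⟨ *-monoʳ-≤ 2 (*-monoʳ-≤ b (+-monoʳ-≤ (1 + q) (s≤s⁻¹ (toℕ<n i)))) ⟩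
    2 * (b * (1 + q + 3))                  ≡⟨ expand b q ⟩
    q * (2 * b) + 8 * b                    ≤⟨ +-mono-≤ (m≤n+m (q * (2 * b)) (K * n % (2 * b))) (≮⇒≥ n≮8b) ⟩
    K * n % (2 * b) + q * (2 * b) + n      ≡⟨ cong (_+ n) division ⟨
    K * n + n                              ≡⟨ +-comm (K * n) n ⟩
    (1 + K) * n                            ≡⟨ cong (_* n) (m+[n∸m]≡n {1} {2 * s} (s≤s z≤n)) ⟩
    2 * s * n                              ≡⟨ *-assoc 2 s n ⟩
    2 * (s * n)                            ∎)
    where
    expand : ∀ b q → 2 * (b * (1 + q + 3)) ≡ q * (2 * b) + 8 * b
    expand = solve-∀

quotient≡1⇒< : ∀ {a b} .{{_ : NonZero a}} → b / a ≡ 1 → b < 2 * a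
quotient≡1⇒< {a} {b} b/a≡1 = ≰⇒> λ 2a≤b →
  <⇒≱ (s≤s (s≤s z≤n)) (subst₂ _≤_ (m*n/n≡m 2 a) b/a≡1 (/-monoˡ-≤ a 2a≤b))

4b+k≤bk : ∀ {b k} → 2 ≤ b → 8 ≤ k → 4 * b + k ≤ b * k
4b+k≤bk 2≤b 8≤k with m≤n⇒∃[o]m+o≡n 2≤b | m≤n⇒∃[o]m+o≡n 8≤k
... | f , refl | e , refl = ≤-trans (m≤m+n _ (e + 4 * f + f * e)) (≤-reflexive (sym (expand f e)))
  where
  expand : ∀ f e → (2 + f) * (8 + e) ≡ 4 * (2 + f) + (8 + e) + (e + 4 * f + f * e)
  expand = solve-∀

-- If b < 2a, then 2c + 2 = 2a + 2b ≥ 3b + 1, and the window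
-- c·k < n < b·(k + 2) gives (3b + 1)k < 2b(k + 2) + 2k, forcing k < 8.
narrow-window : ∀ {a b c n k} → b < 2 * a → 1 + c ≡ a + b → 2 ≤ b →
                c * k < n → n < b * (2 + k) → k < 8
narrow-window {a} {b} {c} {n} {k} b<2a 1+c≡a+b 2≤b ck<n n<b[k+2] = ≰⇒> λ 8≤k →
  <-irrefl refl (begin-strict
    (3 * b + 1) * k                ≤⟨ *-monoˡ-≤ k 3b+1≤2c+2 ⟩
    (2 * c + 2) * k                ≡⟨ spread c k ⟩
    2 * (c * k) + 2 * k            <⟨ +-monoˡ-< (2 * k) (*-monoʳ-< 2 (<-trans ck<n n<b[k+2])) ⟩
    2 * (b * (2 + k)) + 2 * k      ≡⟨ regroup b k ⟩
    2 * (b * k) + (4 * b + k) + k  ≤⟨ +-monoˡ-≤ k (+-monoʳ-≤ (2 * (b * k)) (4b+k≤bk 2≤b 8≤k)) ⟩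
    2 * (b * k) + b * k + k        ≡⟨ collect b k ⟩
    (3 * b + 1) * k                ∎)
  where
  open ≤-Reasoning
  3b+1≤2c+2 : 3 * b + 1 ≤ 2 * c + 2
  3b+1≤2c+2 = begin
    3 * b + 1        ≡⟨ split-3b b ⟩
    (1 + b) + 2 * b  ≤⟨ +-monoˡ-≤ (2 * b) b<2a ⟩
    2 * a + 2 * b    ≡⟨ *-distribˡ-+ 2 a b ⟨
    2 * (a + b)      ≡⟨ cong (2 *_) 1+c≡a+b ⟨
    2 * (1 + c)      ≡⟨ *-comm 2 (1 + c) ⟩
    (1 + c) * 2      ≡⟨ +-comm 2 (c * 2) ⟩
    c * 2 + 2        ≡⟨ cong (_+ 2) (*-comm c 2) ⟩
    2 * c + 2        ∎
    where
    split-3b : ∀ b → 3 * b + 1 ≡ (1 + b) + 2 * b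
    split-3b = solve-∀
  spread : ∀ c k → (2 * c + 2) * k ≡ 2 * (c * k) + 2 * k
  spread = solve-∀
  regroup : ∀ b k → 2 * (b * (2 + k)) + 2 * k ≡ 2 * (b * k) + (4 * b + k) + k
  regroup = solve-∀
  collect : ∀ b k → 2 * (b * k) + b * k + k ≡ (3 * b + 1) * k
  collect = solve-∀

-- The unique integer m in [n/c, n/b] is at most 8: for s = 1 by the narrow
-- window, for s ≥ 2 because n < 8b and bm ≤ n.
multiplier≤8 : ∀ {n a b c s m} .{{_ : NonZero a}} .{{_ : NonZero b}} →
               s ≡ b / a → CondB n b s → NoRunOfFour n → 1 + c ≡ a + b → 2 ≤ a → a ≤ b →
               c * (m ∸ 1) < n → n < b * suc m → b * m ≤ n → m ≤ 8
multiplier≤8 {s = zero} s≡b/a _ _ _ _ a≤b _ _ _ = ⊥-elim (<⇒≱ (m/n≡0⇒m<n (sym s≡b/a)) a≤b)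
multiplier≤8 {s = suc zero} {m = zero} _ _ _ _ _ _ _ _ _ = z≤n
multiplier≤8 {s = suc zero} {m = suc k} s≡b/a _ _ 1+c≡a+b 2≤a a≤b ck<n n<b[k+2] _ =
  narrow-window (quotient≡1⇒< (sym s≡b/a)) 1+c≡a+b (≤-trans 2≤a a≤b) ck<n n<b[k+2]
multiplier≤8 {n} {b = b} {s = suc (suc _)} {m = m} _ condB no-run _ _ _ _ _ bm≤n =
  <⇒≤ (*-cancelˡ-< b m 8 (≤-<-trans bm≤n (subst (n <_) (*-comm 8 b) (condB⇒n<8b (s≤s (s≤s z≤n)) condB no-run))))

∣6³ : ∀ {m} → 1 ≤ m → m ≤ 8 → m ≢ 5 → m ≢ 7 → m ∣ 6 ^ 3
∣6³ {1} _ _ _ _ = divides 216 refl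
∣6³ {2} _ _ _ _ = divides 108 refl
∣6³ {3} _ _ _ _ = divides 72 refl
∣6³ {4} _ _ _ _ = divides 54 refl
∣6³ {5} _ _ m≢5 _ = ⊥-elim (m≢5 refl)
∣6³ {6} _ _ _ _ = divides 36 refl
∣6³ {7} _ _ _ m≢7 = ⊥-elim (m≢7 refl)
∣6³ {8} _ _ _ _ = divides 27 refl
∣6³ {suc (suc (suc (suc (suc (suc (suc (suc (suc _))))))))} _ (s≤s (s≤s (s≤s (s≤s (s≤s (s≤s (s≤s (s≤s ()))))))))

unique-window : ∀ {n b c m} → 1 ≤ m → n ≤ c * m → b * m ≤ n → (∀ k → n ≤ c * k → b * k ≤ n → k ≡ m) →
                n < b * suc m × c * (m ∸ 1) < n
unique-window {n} {b} {c} {m} 1≤m n≤cm bm≤n unique = ≰⇒> next-fails , ≰⇒> previous-fails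
  where
  next-fails : ¬ b * suc m ≤ n
  next-fails b[m+1]≤n = 1+n≢n (unique (suc m) (≤-trans n≤cm (*-monoʳ-≤ c (n≤1+n m))) b[m+1]≤n)
  previous-fails : ¬ n ≤ c * (m ∸ 1)
  previous-fails n≤c[m-1] =
    <-irrefl (unique (m ∸ 1) n≤c[m-1] (≤-trans (*-monoʳ-≤ b (m∸n≤m m 1)) bm≤n)) (∸-monoʳ-< (s≤s z≤n) 1≤m)

-- For a unit m and x < n, x·m = n is impossible (m would divide n, so m = 1).
unit-multiple≢ : ∀ {m n x} → Coprime m n → x < n → x * m ≢ n
unit-multiple≢ {m} {n} {x} unit x<n xm≡n = <-irrefl x≡n x<n
  where
  x≡n : x ≡ n
  x≡n = trans (sym (*-identityʳ x)) (trans (cong (x *_) (sym (unit (∣-refl , divides x (sym xm≡n))))) xm≡n)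

parameter-order : ∀ {n a b} → n < 2 * (n ∸ b) → n ∸ b ≤ n ∸ a → n ∸ a < n ∸ 1 →
                  2 ≤ a × b < n × a ≤ b
parameter-order {n} {a} {b} n<2[n∸b] n∸b≤n∸a n∸a<n∸1 = ∸-cancelʳ-< n∸a<n∸1 , b<n , ∸-cancelʳ-≤ a<n n∸b≤n∸a
  where
  b<n : b < n
  b<n = m∸n≢0⇒n<m (λ n∸b≡0 → <⇒≱ (subst (λ t → n < 2 * t) n∸b≡0 n<2[n∸b]) z≤n)
  a<n : a ≤ n
  a<n = <⇒≤ (m∸n≢0⇒n<m (λ n∸a≡0 → <⇒≱ (m<n⇒0<n∸m b<n) (subst (n ∸ b ≤_) n∸a≡0 n∸b≤n∸a)))

lemma4p4 :
    (n p₁ p₂ p₃ : ℕ) .{{_ : NonZero n}} →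
    Prime p₁ → Prime p₂ → Prime p₃ →
    p₁ ≢ p₂ → p₁ ≢ p₃ → p₂ ≢ p₃ →
    n ≡ p₁ * p₂ * p₃ →
    gcd n 6 ≡ 1 →
    1000 < n →
    (g : ℕ) → HasOrder n g n →
    (a b c : ℕ) .{{_ : NonZero a}} .{{_ : NonZero b}} .{{_ : NonZero c}} →
    1 + c ≡ a + b →
    1 < c → 2 * c < n → n < 2 * (n ∸ b) → n ∸ b ≤ n ∸ a → n ∸ a < n ∸ 1 →
    MinimalZeroSum n (seqS n 1 g c b a) →
    Reduced n g c b a →
    (CondA2 n a b c p₁ p₂ p₃ ⊎ CondA3 n a b c p₁ p₂ p₃ ⊎ CondA4 n a b c p₁ p₂ p₃) →
    (s : ℕ) → s ≡ b / a → s ≤ 9 → CondB n b s →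
    ceilDiv n c < ceilDiv n b →
    (m₁ : ℕ) → n ≤ c * m₁ → b * m₁ ≤ n →
    (∀ k → n ≤ c * k → b * k ≤ n → k ≡ m₁) →
    m₁ ≢ 5 → m₁ ≢ 7 →
    IndexOne n (seqS n 1 g c b a)
lemma4p4 n p₁ p₂ p₃ pr₁ pr₂ pr₃ _ _ _ n≡p₁p₂p₃ gcd[n,6]≡1 _ g order a b c 1+c≡a+b _ 2c<n
         n<2[n∸b] n∸b≤n∸a n∸a<n∸1 minimal _ _ s s≡b/a _ condB _ m₁ n≤cm₁ bm₁≤n unique m₁≢5 m₁≢7 =
  indexOne-of-witness n (proj₁ (proj₂ minimal))
    (multiplier-representation n order unit 1≤m₁ 1+c≡a+b a≤b bm₁<n n<cm₁ cm₁≤2n)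
  where
  cop6 : Coprime n 6
  cop6 = gcd≡1⇒coprime gcd[n,6]≡1
  ordered : 2 ≤ a × b < n × a ≤ b
  ordered = parameter-order n<2[n∸b] n∸b≤n∸a n∸a<n∸1
  2≤a : 2 ≤ a
  2≤a = proj₁ ordered
  b<n : b < n
  b<n = proj₁ (proj₂ ordered)
  a≤b : a ≤ b
  a≤b = proj₂ (proj₂ ordered)
  c<n : c < n
  c<n = ≤-<-trans (m≤m+n c (c + 0)) 2c<n
  1≤m₁ : 1 ≤ m₁
  1≤m₁ = n≢0⇒n>0 λ { refl → ≢-nonZero⁻¹ n (n≤0⇒n≡0 (≤-trans n≤cm₁ (≤-reflexive (*-zeroʳ c)))) }
  window : n < b * suc m₁ × c * (m₁ ∸ 1) < n
  window = unique-window {n} {b} {c} 1≤m₁ n≤cm₁ bm₁≤n unique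
  m₁≤8 : m₁ ≤ 8
  m₁≤8 = multiplier≤8 s≡b/a condB (no-run-of-four pr₁ pr₂ pr₃ n≡p₁p₂p₃ cop6)
                      1+c≡a+b 2≤a a≤b (proj₂ window) (proj₁ window) bm₁≤n
  unit : Coprime m₁ n
  unit = ∣power⇒coprime 3 cop6 (∣6³ 1≤m₁ m₁≤8 m₁≢5 m₁≢7)
  bm₁<n : b * m₁ < n
  bm₁<n = ≤∧≢⇒< bm₁≤n (unit-multiple≢ unit b<n)
  n<cm₁ : n < c * m₁
  n<cm₁ = ≤∧≢⇒< n≤cm₁ (λ n≡cm₁ → unit-multiple≢ unit c<n (sym n≡cm₁))
  cm₁≤2n : c * m₁ ≤ n + n
  cm₁≤2n = subst (_≤ n + n) (trans (sym (*-suc c (m₁ ∸ 1))) (cong (c *_) (m+[n∸m]≡n 1≤m₁)))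
                 (+-mono-≤ (<⇒≤ c<n) (<⇒≤ (proj₂ window)))
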